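{- Let $a\ge1$ and $x\ge2$ be integers, let $n=2^a$, and let $\omega_n$ be the number of distinct prime factors of $x^n-1$. Then $$x\;\ge\;\min\left[\left(1+2n\prod_{i=1}^{\omega_n}s_i\right)^{1/n},\ \left(1+\prod_{i=2}^{\omega_n+1}s_i\right)^{1/n}\right],$$ where $s_i$ denotes the $i$-th prime. -}

module Defs where

open import Data.Nat using (ℕ; zero; suc; _*_; _+_; _≤_; _⊓_)
open import Data.Nat.Divisibility using (_∣?_)
open import Data.Nat.Primality using (Prime; prime?)
open import Data.List using (List; length; filter; upTo)
open import Data.Product using (_×_)
open import Relation.Binary.PropositionalEquality using (_≡_)
open import Relation.Nullary.Decidable using (_×-dec_)

upToIncl : ℕ → List ℕ
upToIncl m = upTo (suc m)

ω : ℕ → ℕ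
ω m = length (filter (λ p → prime? p ×-dec (p ∣? m)) (upToIncl m))

primeCount : ℕ → ℕ
primeCount m = length (filter prime? (upToIncl m))

-- p is the i-th prime (1-indexed: the 1st prime is 2)
IsIthPrime : ℕ → ℕ → Set
IsIthPrime i p = Prime p × primeCount p ≡ i

-- ∏_{i = a}^{a + k - 1} s i   (product of k consecutive terms starting at index a)
prodFrom : (ℕ → ℕ) → ℕ → ℕ → ℕ
prodFrom s a zero    = 1
prodFrom s a (suc k) = s a * prodFrom s (suc a) k

-- Let N = x ^ n - 1 with n = 2 ^ a. In increasing order, the j-th odd prime divisor of N is at
-- least the (j+1)-th prime, and these primes are coprime to any power of 2 dividing N, so their
-- product times that power still divides N. If x is even, N is odd and hence
-- s 2 ⋯ s (ω + 1) ≤ N. If x is odd, squaring 1 + 2k repeatedly gives 2 ^ (a + 2) ∣ N; the prime 2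
-- is then one of the ω prime divisors, so 2n · s 1 ⋯ s ω = 2 ^ (a + 2) · s 2 ⋯ s ω ≤ N.
module Submission where

open import Defs
open import Data.Nat
  using (ℕ; zero; suc; _*_; _+_; _^_; _∸_; _⊓_; _≤_; _<_; _≤′_; ≤′-refl; ≤′-step; s≤s; z<s;
         NonZero; >-nonZero; nonTrivial⇒n>1)
open import Data.Nat.Properties
open import Data.Nat.Divisibility
  using (_∣_; _∤_; _∣?_; divides; hasNonTrivialDivisor; _∣0; 1∣_; m∣m*n; ∣⇒≤; >⇒∤; ∣1⇒≡1; ∣m+n∣m⇒∣n; ∣-trans)
open import Data.Nat.ListAction using (product)
open import Data.Nat.Tactic.RingSolver using (solve-∀)
open import Data.Nat.Primality
open import Data.List using (List; []; _∷_; [_]; _++_; length; filter; upTo; applyUpTo)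
open import Data.List.Properties using (upTo-∷ʳ; filter-++; length-++; filter-accept; filter-reject)
open import Data.List.Relation.Unary.All as All using (All; []; _∷_)
import Data.List.Relation.Unary.All.Properties as Allₚ
open import Data.List.Relation.Unary.AllPairs using (AllPairs; []; _∷_)
import Data.List.Relation.Unary.AllPairs.Properties as AllPairsₚ
open import Data.Product using (∃; _×_; _,_; proj₁; proj₂)
open import Data.Sum using (_⊎_; inj₁; inj₂; [_,_]′)
open import Function using (_∘_)
open import Relation.Binary.PropositionalEquality using (_≡_; refl; sym; trans; cong; subst; module ≡-Reasoning)
open import Relation.Nullary using (Dec; contradiction)
open import Relation.Nullary.Decidable using (_×-dec_)

primeCount-suc : ∀ m → primeCount (suc m) ≡ primeCount m + length (filter prime? [ suc m ])
primeCount-suc m = begin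
  length (filter prime? (upTo (suc (suc m))))
    ≡⟨ cong (length ∘ filter prime?) (upTo-∷ʳ (suc m)) ⟨
  length (filter prime? (upTo (suc m) ++ [ suc m ]))
    ≡⟨ cong length (filter-++ prime? (upTo (suc m)) [ suc m ]) ⟩
  length (filter prime? (upTo (suc m)) ++ filter prime? [ suc m ])
    ≡⟨ length-++ (filter prime? (upTo (suc m))) ⟩
  primeCount m + length (filter prime? [ suc m ]) ∎
  where open ≡-Reasoning

primeCount-≤-suc : ∀ m → primeCount m ≤ primeCount (suc m)
primeCount-≤-suc m rewrite primeCount-suc m = m≤m+n _ _

primeCount-mono-≤ : ∀ {m n} → m ≤ n → primeCount m ≤ primeCount n
primeCount-mono-≤ = mono′ ∘ ≤⇒≤′
  where
  mono′ : ∀ {m n} → m ≤′ n → primeCount m ≤ primeCount n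
  mono′ ≤′-refl           = ≤-refl
  mono′ (≤′-step {n} m≤n) = ≤-trans (mono′ m≤n) (primeCount-≤-suc n)

primeCount-suc-prime : ∀ {m} → Prime (suc m) → primeCount (suc m) ≡ suc (primeCount m)
primeCount-suc-prime {m} 1+m-prime rewrite primeCount-suc m | filter-accept prime? {xs = []} 1+m-prime =
  +-comm (primeCount m) 1

primeCount-< : ∀ {p q} → Prime q → p < q → primeCount p < primeCount q
primeCount-< {q = suc q} q-prime (s≤s p≤q) rewrite primeCount-suc-prime q-prime =
  s≤s (primeCount-mono-≤ p≤q)

IsPrimeEnumeration : (ℕ → ℕ) → Set
IsPrimeEnumeration s = ∀ i → 1 ≤ i → IsIthPrime i (s i)

ithPrime≤ : ∀ {i t q} → IsIthPrime i t → Prime q → i ≤ primeCount q → t ≤ q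
ithPrime≤ {q = q} (t-prime , πt≡i) q-prime i≤πq =
  ≮⇒≥ (λ q<t → <⇒≱ (subst (primeCount q <_) πt≡i (primeCount-< t-prime q<t)) i≤πq)

prime⇒≥2 : ∀ {p} → Prime p → 2 ≤ p
prime⇒≥2 p-prime = nonTrivial⇒n>1 _ {{prime⇒nonTrivial p-prime}}

firstPrime≡2 : ∀ {s} → IsPrimeEnumeration s → s 1 ≡ 2
firstPrime≡2 enum =
  ≤-antisym (ithPrime≤ (enum 1 ≤-refl) prime[2] ≤-refl) (prime⇒≥2 (proj₁ (enum 1 ≤-refl)))

prodFrom≤product : ∀ {s} → IsPrimeEnumeration s → ∀ {j L} → 1 ≤ j → AllPairs _<_ L → All Prime L
                 → All (λ p → j ≤ primeCount p) L → prodFrom s j (length L) ≤ product L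
prodFrom≤product enum 1≤j [] [] [] = ≤-refl
prodFrom≤product enum {j} 1≤j (p<L ∷ sorted) (p-prime ∷ primes) (j≤πp ∷ _) =
  *-mono-≤ (ithPrime≤ (enum j 1≤j) p-prime j≤πp)
           (prodFrom≤product enum z<s sorted primes (All.zipWith πq>j (p<L , primes)))
  where
  πq>j : ∀ {q} → _ < q × Prime q → j < primeCount q
  πq>j (p<q , q-prime) = ≤-trans (s≤s j≤πp) (primeCount-< q-prime p<q)

prime∤larger-prime : ∀ {p q} → Prime p → Prime q → p < q → p ∤ q
prime∤larger-prime p-prime q-prime p<q p∣q =
  prime⇒¬composite q-prime (hasNonTrivialDivisor {{prime⇒nonTrivial p-prime}} p<q p∣q)

prime∤1 : ∀ {p} → Prime p → p ∤ 1
prime∤1 p-prime = >⇒∤ (prime⇒≥2 p-prime)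

prime∤* : ∀ {p m n} → Prime p → p ∤ m → p ∤ n → p ∤ m * n
prime∤* {m = m} {n} p-prime p∤m p∤n p∣mn = [ p∤m , p∤n ]′ (euclidsLemma m n p-prime p∣mn)

prime∤product : ∀ {p L} → Prime p → All (p ∤_) L → p ∤ product L
prime∤product p-prime []            = prime∤1 p-prime
prime∤product p-prime (p∤q ∷ p∤L) = prime∤* p-prime p∤q (prime∤product p-prime p∤L)

prime∤^ : ∀ {p m} → Prime p → p ∤ m → ∀ e → p ∤ m ^ e
prime∤^ p-prime p∤m zero    = prime∤1 p-prime
prime∤^ p-prime p∤m (suc e) = prime∤* p-prime p∤m (prime∤^ p-prime p∤m e)

prime*∣ : ∀ {p m n} → Prime p → p ∤ m → p ∣ n → m ∣ n → p * m ∣ n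
prime*∣ {p} {m} {n} p-prime p∤m p∣n (divides k n≡km)
  with euclidsLemma m k p-prime (subst (p ∣_) (trans n≡km (*-comm k m)) p∣n)
... | inj₁ p∣m = contradiction p∣m p∤m
... | inj₂ (divides r k≡rp) = divides r (begin
  n           ≡⟨ n≡km ⟩
  k * m       ≡⟨ cong (_* m) k≡rp ⟩
  r * p * m   ≡⟨ *-assoc r p m ⟩
  r * (p * m) ∎)
  where open ≡-Reasoning

product*∣ : ∀ {c N L} → AllPairs _<_ L → All Prime L → All (_∣ N) L → All (_∤ c) L → c ∣ N
          → product L * c ∣ N
product*∣ {c} {N} [] [] [] [] c∣N = subst (_∣ N) (sym (*-identityˡ c)) c∣N
product*∣ {c} {N} {p ∷ L} (p<L ∷ sorted) (p-prime ∷ primes) (p∣N ∷ L∣N) (p∤c ∷ L∤c) c∣N =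
  subst (_∣ N) (sym (*-assoc p (product L) c))
    (prime*∣ p-prime (prime∤* p-prime p∤L p∤c) p∣N (product*∣ sorted primes L∣N L∤c c∣N))
  where
  p∤L : p ∤ product L
  p∤L = prime∤product p-prime
          (All.zipWith (λ (p<q , q-prime) → prime∤larger-prime p-prime q-prime p<q) (p<L , primes))

PrimeDivisorOf : ℕ → ℕ → Set
PrimeDivisorOf N p = Prime p × p ∣ N

primeDivisorOf? : ∀ N p → Dec (PrimeDivisorOf N p)
primeDivisorOf? N p = prime? p ×-dec p ∣? N

oddPrimeDivisors : ℕ → List ℕ
oddPrimeDivisors N = filter (primeDivisorOf? N) (applyUpTo (3 +_) (N ∸ 2))

oddPrimeDivisors-sorted : ∀ N → AllPairs _<_ (oddPrimeDivisors N)
oddPrimeDivisors-sorted N =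
  AllPairsₚ.filter⁺ (primeDivisorOf? N)
    (AllPairsₚ.applyUpTo⁺₁ (3 +_) (N ∸ 2) (λ i<j _ → +-monoʳ-< 3 i<j))

oddPrimeDivisors-divide : ∀ N → All (PrimeDivisorOf N) (oddPrimeDivisors N)
oddPrimeDivisors-divide N = Allₚ.all-filter (primeDivisorOf? N) (applyUpTo (3 +_) (N ∸ 2))

oddPrimeDivisors-≥3 : ∀ N → All (3 ≤_) (oddPrimeDivisors N)
oddPrimeDivisors-≥3 N = Allₚ.filter⁺ (primeDivisorOf? N) (Allₚ.applyUpTo⁺₂ (3 +_) (N ∸ 2) (m≤m+n 3))

-- ω N filters the candidates 0, 1, …, N; 0 and 1 are discarded by evaluation, 2 needs a proof.
ω-odd : ∀ {N} → 2 ∤ N → ω N ≡ length (oddPrimeDivisors N)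
ω-odd {zero}        2∤0 = contradiction (2 ∣0) 2∤0
ω-odd {1}           _   = refl
ω-odd {suc (suc M)} 2∤N = cong length (filter-reject (primeDivisorOf? (2 + M)) (2∤N ∘ proj₂))

ω-even : ∀ {N} → .{{NonZero N}} → 2 ∣ N → ω N ≡ suc (length (oddPrimeDivisors N))
ω-even {1}           2∣1 = contradiction (∣1⇒≡1 2∣1) λ ()
ω-even {suc (suc M)} 2∣N = cong length (filter-accept (primeDivisorOf? (2 + M)) (prime[2] , 2∣N))

prodFrom-oddPrimeDivisors≤ : ∀ {s} → IsPrimeEnumeration s → ∀ {N e} → .{{NonZero N}} → 2 ^ e ∣ N
                           → prodFrom s 2 (length (oddPrimeDivisors N)) * 2 ^ e ≤ N
prodFrom-oddPrimeDivisors≤ {s} enum {N} {e} 2^e∣N = begin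
  prodFrom s 2 (length D) * 2 ^ e ≤⟨ *-monoˡ-≤ (2 ^ e) (prodFrom≤product enum z<s sorted primes π≥2) ⟩
  product D * 2 ^ e                ≤⟨ ∣⇒≤ (product*∣ sorted primes divisors ∤2^e 2^e∣N) ⟩
  N                                ∎
  where
  open ≤-Reasoning
  D : List ℕ
  D = oddPrimeDivisors N
  sorted : AllPairs _<_ D
  sorted = oddPrimeDivisors-sorted N
  primes : All Prime D
  primes = All.map proj₁ (oddPrimeDivisors-divide N)
  divisors : All (_∣ N) D
  divisors = All.map proj₂ (oddPrimeDivisors-divide N)
  π≥2 : All (λ p → 2 ≤ primeCount p) D
  π≥2 = All.map (primeCount-mono-≤ {3}) (oddPrimeDivisors-≥3 N)
  ∤2^e : All (_∤ 2 ^ e) D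
  ∤2^e = All.zipWith (λ (p-prime , 3≤p) → prime∤^ p-prime (>⇒∤ 3≤p) e) (primes , oddPrimeDivisors-≥3 N)

prodFrom-ω≤-odd : ∀ {s} → IsPrimeEnumeration s → ∀ {N} → 2 ∤ N → prodFrom s 2 (ω N) ≤ N
prodFrom-ω≤-odd enum {zero} 2∤0 = contradiction (2 ∣0) 2∤0
prodFrom-ω≤-odd {s} enum {N@(suc _)} 2∤N = begin
  prodFrom s 2 (ω N)                             ≡⟨ cong (prodFrom s 2) (ω-odd 2∤N) ⟩
  prodFrom s 2 (length (oddPrimeDivisors N))     ≡⟨ *-identityʳ _ ⟨
  prodFrom s 2 (length (oddPrimeDivisors N)) * 1 ≤⟨ prodFrom-oddPrimeDivisors≤ enum {e = 0} (1∣ N) ⟩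
  N                                              ∎
  where open ≤-Reasoning

prodFrom-ω≤-even : ∀ {s} → IsPrimeEnumeration s → ∀ {N e} → .{{NonZero N}} → 2 ^ suc e ∣ N
                 → 2 ^ e * prodFrom s 1 (ω N) ≤ N
prodFrom-ω≤-even {s} enum {N} {e} 2^[1+e]∣N = begin
  2 ^ e * prodFrom s 1 (ω N)   ≡⟨ cong (λ k → 2 ^ e * prodFrom s 1 k) (ω-even 2∣N) ⟩
  2 ^ e * (s 1 * P)            ≡⟨ cong (λ p → 2 ^ e * (p * P)) (firstPrime≡2 enum) ⟩
  2 ^ e * (2 * P)              ≡⟨ regroup (2 ^ e) P ⟩
  P * 2 ^ suc e                ≤⟨ prodFrom-oddPrimeDivisors≤ enum {e = suc e} 2^[1+e]∣N ⟩
  N                            ∎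
  where
  open ≤-Reasoning
  P : ℕ
  P = prodFrom s 2 (length (oddPrimeDivisors N))
  2∣N : 2 ∣ N
  2∣N = ∣-trans (m∣m*n (2 ^ e)) 2^[1+e]∣N
  regroup : ∀ a p → a * (2 * p) ≡ p * (2 * a)
  regroup = solve-∀

even⊎odd : ∀ n → (∃ λ k → n ≡ 2 * k) ⊎ (∃ λ k → n ≡ 1 + 2 * k)
even⊎odd zero = inj₁ (0 , refl)
even⊎odd (suc n) with even⊎odd n
... | inj₁ (k , refl) = inj₂ (k , refl)
... | inj₂ (k , refl) = inj₁ (suc k , cong suc (sym (+-suc k (k + 0))))

m^2≡m*m : ∀ m → m ^ 2 ≡ m * m
m^2≡m*m m = cong (m *_) (*-identityʳ m)

square-1+4v : ∀ v → (1 + 2 * (2 * v)) * (1 + 2 * (2 * v)) ≡ 1 + (v + 2 * v * v) * 8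
square-1+4v = solve-∀

square-3+4v : ∀ v → (1 + 2 * (1 + 2 * v)) * (1 + 2 * (1 + 2 * v)) ≡ 1 + (1 + 3 * v + 2 * v * v) * 8
square-3+4v = solve-∀

square-1+2rq : ∀ r q → (1 + r * (2 * q)) * (1 + r * (2 * q)) ≡ 1 + (r + r * r * q) * (2 * (2 * q))
square-1+2rq = solve-∀

odd^2^[1+b]≡1+t*2^[3+b] : ∀ k b → ∃ λ t → (1 + 2 * k) ^ 2 ^ suc b ≡ 1 + t * 2 ^ (3 + b)
odd^2^[1+b]≡1+t*2^[3+b] k zero with even⊎odd k
... | inj₁ (v , refl) = v + 2 * v * v , trans (m^2≡m*m (1 + 2 * (2 * v))) (square-1+4v v)
... | inj₂ (v , refl) = 1 + 3 * v + 2 * v * v , trans (m^2≡m*m (1 + 2 * (1 + 2 * v))) (square-3+4v v)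
odd^2^[1+b]≡1+t*2^[3+b] k (suc b) with odd^2^[1+b]≡1+t*2^[3+b] k b
... | t , x^n≡1+tQ = t + t * t * 2 ^ (2 + b) , (begin
  x ^ (2 * n)                             ≡⟨ cong (x ^_) (*-comm 2 n) ⟩
  x ^ (n * 2)                             ≡⟨ ^-*-assoc x n 2 ⟨
  (x ^ n) ^ 2                             ≡⟨ cong (_^ 2) x^n≡1+tQ ⟩
  (1 + t * Q) ^ 2                         ≡⟨ m^2≡m*m (1 + t * Q) ⟩
  (1 + t * Q) * (1 + t * Q)               ≡⟨ square-1+2rq t (2 ^ (2 + b)) ⟩
  1 + (t + t * t * 2 ^ (2 + b)) * (2 * Q) ∎)
  where
  open ≡-Reasoning
  x n Q : ℕ
  x = 1 + 2 * k
  n = 2 ^ suc b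
  Q = 2 ^ (3 + b)

2∣⇒2∤∸1 : ∀ {X} → .{{NonZero X}} → 2 ∣ X → 2 ∤ X ∸ 1
2∣⇒2∤∸1 {suc N} 2∣1+N 2∣N =
  contradiction (∣1⇒≡1 (∣m+n∣m⇒∣n (subst (2 ∣_) (+-comm 1 N) 2∣1+N) 2∣N)) λ ()

m∣m^n : ∀ m n → .{{NonZero n}} → m ∣ m ^ n
m∣m^n m (suc n) = m∣m*n (m ^ n)

≤∸1⇒< : ∀ {m n} → .{{NonZero n}} → m ≤ n ∸ 1 → m < n
≤∸1⇒< {n = suc n} = s≤s

theorem1p3 : (a x : ℕ) → 1 ≤ a → 2 ≤ x → (s : ℕ → ℕ) → (∀ i → 1 ≤ i → IsIthPrime i (s i))
             → (1 + 2 * (2 ^ a) * prodFrom s 1 (ω (x ^ (2 ^ a) ∸ 1))) ⊓ (1 + prodFrom s 2 (ω (x ^ (2 ^ a) ∸ 1))) ≤ x ^ (2 ^ a)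
theorem1p3 (suc b) x _ 2≤x s enum = ≤∸1⇒< bound
  where
  n X : ℕ
  n = 2 ^ suc b
  X = x ^ n
  X≥2 : 2 ≤ X
  X≥2 = ^-monoʳ-< x 2≤x (m^n>0 2 (suc b))
  instance
    n≢0 : NonZero n
    n≢0 = m^n≢0 2 (suc b)
    X≢0 : NonZero X
    X≢0 = >-nonZero (<-trans z<s X≥2)
    X∸1≢0 : NonZero (X ∸ 1)
    X∸1≢0 = >-nonZero (m<n⇒0<n∸m X≥2)
  bound : 2 * n * prodFrom s 1 (ω (X ∸ 1)) ⊓ prodFrom s 2 (ω (X ∸ 1)) ≤ X ∸ 1
  bound with even⊎odd x
  ... | inj₁ (k , x≡2k) = ≤-trans (m⊓n≤n _ _) (prodFrom-ω≤-odd enum (2∣⇒2∤∸1 2∣X))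
    where
    2∣X : 2 ∣ X
    2∣X = ∣-trans (subst (2 ∣_) (sym x≡2k) (m∣m*n k)) (m∣m^n x n)
  ... | inj₂ (k , x≡1+2k) with odd^2^[1+b]≡1+t*2^[3+b] k b
  ...   | t , [1+2k]^n≡1+t*2^[3+b] = ≤-trans (m⊓n≤m _ _) (prodFrom-ω≤-even enum {e = 2 + b} 2^[3+b]∣X∸1)
    where
    2^[3+b]∣X∸1 : 2 ^ (3 + b) ∣ X ∸ 1
    2^[3+b]∣X∸1 = divides t (cong (_∸ 1) (trans (cong (_^ n) x≡1+2k) [1+2k]^n≡1+t*2^[3+b]))
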